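{- Let $G$ and $H$ be nontrivial graphs with $G$ connected. Then $${\rm gp}(G\circ H)=\max_{S\in\mathcal{G}_{2,2}}\big\{|\mathcal{I}_S|\,{\rm sjc}_2(H)+|\mathcal{J}_S|\,\omega(H)\big\}.$$
   Context: Graphs are finite and simple; nontrivial means at least two vertices. The lexicographic product $G\circ H$ has vertex set $V(G)\times V(H)$, with $(g,h)$ adjacent to $(g',h')$ iff $gg'\in E(G)$, or $g=g'$ and $hh'\in E(H)$. A general position set of a graph $X$ is a set of vertices no three of which lie on a common shortest path; ${\rm gp}(X)$ is the largest size of a general position set. $\mathcal{G}_{2,2}$ is the family of all general position sets of $G$. For $S\subseteq V(G)$, $\mathcal{I}_S$ is the set of isolated vertices of the induced subgraph $G[S]$ and $\mathcal{J}_S=S\setminus\mathcal{I}_S$. $\omega(H)$ is the clique number of $H$. For a graph $X$ and nonempty $W\subseteq V(X)$, $d_X(W)$ is the minimum number of edges of a connected subgraph of $X$ containing $W$ ($\infty$ if none). A set $A\subseteq V(H)$ with $|A|\ge 2$ is $2$-Steiner join-critical if $d_{H[A]}(B)\ne 2$ for every $2$-subset $B\subseteq A$ (where $H[A]$ is the induced subgraph); ${\rm sjc}_2(H)$ is the largest size of such a set. -}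

module Defs where

open import Data.Nat using (ℕ; zero; suc; _+_; _*_; _≤_)
open import Data.Bool using (Bool; true; false; _∧_; _∨_; not; T)
open import Data.Fin using (Fin; remQuot; _≟_)
open import Data.Fin.Subset using (Subset; _∈_; _⊆_; ∣_∣; _─_)
open import Data.Vec using (lookup; tabulate)
open import Data.List using (List; length)
open import Data.List.Membership.Propositional using () renaming (_∈_ to _∈ₗ_)
open import Data.Product using (Σ; ∃; _×_; _,_; proj₁; proj₂)
open import Data.Sum using (_⊎_)
open import Relation.Binary.PropositionalEquality using (_≡_; _≢_)
open import Relation.Nullary using (¬_)
open import Relation.Nullary.Decidable using (⌊_⌋)

record Graph : Set where
  field
    n : ℕ
    E : Fin n → Fin n → Bool
open Graph public

IsSimple : Graph → Set
IsSimple G = (∀ u v → E G u v ≡ E G v u) × (∀ u → E G u u ≡ false)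

Nontrivial : Graph → Set
Nontrivial G = 2 ≤ n G

Adj : (G : Graph) → Fin (n G) → Fin (n G) → Set
Adj G u v = T (E G u v)

data Walk {m : ℕ} (R : Fin m → Fin m → Set) : Fin m → Fin m → ℕ → Set where
  stop : ∀ u → Walk R u u zero
  step : ∀ {u v w k} → R u v → Walk R v w k → Walk R u w (suc k)

vertices : ∀ {m} {R : Fin m → Fin m → Set} {u v k} → Walk R u v k → List (Fin m)
vertices (stop u) = u Data.List.∷ Data.List.[]
vertices (step {u = u} _ w) = u Data.List.∷ vertices w

Connected : Graph → Set
Connected G = ∀ u v → ∃ λ k → Walk (Adj G) u v k

IsShortest : (G : Graph) {u v : Fin (n G)} {k : ℕ} → Walk (Adj G) u v k → Set
IsShortest G {u} {v} {k} _ = ∀ k′ → Walk (Adj G) u v k′ → k ≤ k′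

OnCommonGeodesic : (G : Graph) → Fin (n G) → Fin (n G) → Fin (n G) → Set
OnCommonGeodesic G x y z =
  Σ (Fin (n G)) λ u → Σ (Fin (n G)) λ v → Σ ℕ λ k → Σ (Walk (Adj G) u v k) λ w →
    IsShortest G w × x ∈ₗ vertices w × y ∈ₗ vertices w × z ∈ₗ vertices w

IsGPSet : (G : Graph) → Subset (n G) → Set
IsGPSet G S = ∀ x y z → x ∈ S → y ∈ S → z ∈ S →
  x ≢ y → y ≢ z → x ≢ z → ¬ OnCommonGeodesic G x y z

IsMax : (ℕ → Set) → ℕ → Set
IsMax P k = P k × (∀ m → P m → m ≤ k)

IsMin : (ℕ → Set) → ℕ → Set
IsMin P k = P k × (∀ m → P m → k ≤ m)

IsGP : Graph → ℕ → Set
IsGP G = IsMax λ k → Σ (Subset (n G)) λ S → IsGPSet G S × ∣ S ∣ ≡ k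

IsClique : (G : Graph) → Subset (n G) → Set
IsClique G S = ∀ x y → x ∈ S → y ∈ S → x ≢ y → Adj G x y

IsCliqueNumber : Graph → ℕ → Set
IsCliqueNumber G = IsMax λ k → Σ (Subset (n G)) λ S → IsClique G S × ∣ S ∣ ≡ k

-- A subgraph of H[A] is given by a vertex set U ⊆ A and a list F of edges of H
-- with both endpoints in U; its number of edges is the length of F.
-- (Lists with repeated edges only have larger length, so the minimum is unaffected.)

EdgeRel : ∀ {m} → List (Fin m × Fin m) → Fin m → Fin m → Set
EdgeRel F a b = ((a , b) ∈ₗ F) ⊎ ((b , a) ∈ₗ F)

IsConnSubgraphContaining : (H : Graph) → (A W U : Subset (n H)) →
  List (Fin (n H) × Fin (n H)) → Set
IsConnSubgraphContaining H A W U F =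
  U ⊆ A × W ⊆ U
  × (∀ a b → (a , b) ∈ₗ F → Adj H a b × a ∈ U × b ∈ U)
  × (∀ a b → a ∈ U → b ∈ U → ∃ λ k → Walk (EdgeRel F) a b k)

-- d_{H[A]}(W) = k   (if no connected subgraph contains W, no k satisfies this: d = ∞)
SteinerDistInduced : (H : Graph) → Subset (n H) → Subset (n H) → ℕ → Set
SteinerDistInduced H A W = IsMin λ k →
  Σ (Subset (n H)) λ U → Σ (List (Fin (n H) × Fin (n H))) λ F →
    IsConnSubgraphContaining H A W U F × length F ≡ k

Is2SJC : (H : Graph) → Subset (n H) → Set
Is2SJC H A = 2 ≤ ∣ A ∣ ×
  (∀ B → B ⊆ A → ∣ B ∣ ≡ 2 → ¬ SteinerDistInduced H A B 2)

IsSjc2 : Graph → ℕ → Set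
IsSjc2 H = IsMax λ k → Σ (Subset (n H)) λ A → Is2SJC H A × ∣ A ∣ ≡ k

anyFin : ∀ {m} → (Fin m → Bool) → Bool
anyFin {zero} f = false
anyFin {suc m} f = f Fin.zero ∨ anyFin (λ i → f (Fin.suc i))

Isol : (G : Graph) → Subset (n G) → Subset (n G)
Isol G S = tabulate λ x → lookup S x ∧ not (anyFin λ y → lookup S y ∧ E G x y)

NonIsol : (G : Graph) → Subset (n G) → Subset (n G)
NonIsol G S = S ─ Isol G S

-- Lexicographic product G ∘ H on Fin (n G * n H); vertex (g , h) is encoded
-- as combine g h, decoded by remQuot.

lex : Graph → Graph → Graph
lex G H = record { n = n G * n H ; E = e }
  where
  e : Fin (n G * n H) → Fin (n G * n H) → Bool
  e x y with remQuot {n G} (n H) x | remQuot {n G} (n H) y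
  ... | g , h | g′ , h′ = E G g g′ ∨ (⌊ g ≟ g′ ⌋ ∧ E H h h′)

-- A general position set X of G ∘ H projects to a general position set S of G: a geodesic of G
-- lifts, through chosen representatives, to a geodesic of G ∘ H. Each fibre of X is P₃-free in H,
-- since an induced path h – h′ – h″ inside one fibre is a geodesic of G ∘ H; the fibre over a vertex
-- with a neighbour g′ in S is even a clique, since two non-adjacent vertices of it are at distance
-- two through the fibre over g′. A set of at least two vertices is 2-Steiner join-critical exactly
-- when it is P₃-free, so summing over the fibres gives |X| ≤ |I_S| sjc₂(H) + |J_S| ω(H).
-- Conversely, for S in general position, A a largest 2-Steiner join-critical set and C a largest
-- clique of H, the set (I_S × A) ∪ (J_S × C) is in general position: three of its vertices on a
-- geodesic either project to three vertices of S on a geodesic of G, or two of them lie in one fibre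
-- at distance two, which yields an induced P₃ in A, a non-edge in C, or an edge of G at an isolated
-- vertex of S. General position sets of G are decidable, so the maximum over S exists.

module Submission where

open import Defs
open import Data.Bool using (Bool; true; false; T; _∨_; _∧_; not; if_then_else_)
open import Data.Bool.Properties using (T-∨; T-∧)
open import Data.Empty using (⊥; ⊥-elim)
open import Data.Fin using (Fin; _≟_; remQuot; combine; _↑ˡ_; _↑ʳ_)
open import Data.Fin.Properties using (any?; all?; remQuot-combine; combine-remQuot)
import Data.Fin.Properties
open import Data.Fin.Subset using (Subset; _∈_; _∉_; _⊆_; ∣_∣; _∪_; _─_; ⁅_⁆; inside; outside)
  renaming (⊥ to ⊥ₛ)
open import Data.Fin.Subset.Properties
  using (x∈p∪q⁺; x∈p∪q⁻; x∈⁅x⁆; x∈⁅y⁆⇒x≡y; ∣⁅x⁆∣≡1; ∪-identityˡ; ∪-identityʳ; ∉⊥; x∈p∧x∉q⇒x∈p─q; p─q⊆p;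
         nonempty?; Empty-unique; ∣⊥∣≡0; ∣p∣≤n; anySubset?)
  renaming (_∈?_ to _∈ₛ?_)
open import Data.List using (List; []; _∷_; length)
import Data.List as List
open import Data.List.Membership.Propositional using () renaming (_∈_ to _∈ₗ_)
open import Data.List.Relation.Unary.Any using (here; there; index)
open import Data.List.Relation.Unary.Any.Properties using (lookup-index)
open import Data.Nat using (ℕ; zero; suc; _+_; _*_; _≤_; _<_; z≤n; s≤s) renaming (_≟_ to _≟ℕ_)
open import Data.Nat.Properties
  using (≤-trans; ≤-reflexive; ≤-pred; +-assoc; +-comm; +-suc; +-identityʳ; +-mono-≤; +-cancelˡ-≤; +-cancelʳ-≤;
         m≤n⇒m≤1+n; ≰⇒>; <⇒≱; 1+n≰n; m+n≮n; suc-injective; ≤∧≢⇒<; _≤?_; anyUpTo?; allUpTo?)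
import Data.Nat.Properties
open import Algebra.Properties.Semiring.Sum Data.Nat.Properties.+-*-semiring
  using (sum; sum-cong-≗; ∑-distrib-+; *-distribʳ-sum)
open import Data.Product using (Σ; ∃; ∃₂; _×_; _,_; proj₁; proj₂)
import Data.Product
open import Data.Sum using (_⊎_; inj₁; inj₂)
import Data.Sum as Sum
open import Data.Unit using (⊤; tt)
open import Data.Vec using ([]; _∷_; lookup; tabulate)
open import Data.Vec.Base using (here; there)
open import Data.Vec.Functional using (updateAt)
open import Data.Vec.Functional.Properties using (updateAt-updates; updateAt-minimal)
open import Data.Vec.Properties using (lookup∘tabulate; tabulate∘lookup; tabulate-cong; []=⇒lookup; lookup⇒[]=)
open import Function using (_∘_)
open import Function.Bundles using (Equivalence)
open import Relation.Binary using (Decidable)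
open import Relation.Binary.PropositionalEquality
open import Relation.Nullary using (¬_; Dec; yes; no)
open import Relation.Nullary.Decidable using (map′; _×-dec_; _→-dec_; ¬?; T?; ⌊_⌋; toWitness; fromWitness)

positive-summand : ∀ {i j} → 1 ≤ i → ¬ (i + j ≤ j)
positive-summand {suc i} {j} _ = m+n≮n i j

both-one : ∀ {i j} → 1 ≤ i → 1 ≤ j → i + j ≤ 2 → i ≡ 1 × j ≡ 1
both-one {1} {1} _ _ _ = refl , refl
both-one {1} {suc (suc j)} _ _ (s≤s (s≤s ()))
both-one {suc (suc i)} {suc j} _ _ (s≤s (s≤s i+1+j≤0)) with () ← subst (_≤ 0) (+-suc i j) i+1+j≤0

module _ {m : ℕ} {R : Fin m → Fin m → Set} where

  infixr 5 _++ʷ_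

  _++ʷ_ : ∀ {a b c i j} → Walk R a b i → Walk R b c j → Walk R a c (i + j)
  stop _ ++ʷ w′ = w′
  step r w ++ʷ w′ = step r (w ++ʷ w′)

  start∈vertices : ∀ {a b k} (w : Walk R a b k) → a ∈ₗ vertices w
  start∈vertices (stop _) = here refl
  start∈vertices (step _ _) = here refl

  end∈vertices : ∀ {a b k} (w : Walk R a b k) → b ∈ₗ vertices w
  end∈vertices (stop _) = here refl
  end∈vertices (step _ w) = there (end∈vertices w)

  ∈-++ʷʳ : ∀ {a b c i j x} (w : Walk R a b i) (w′ : Walk R b c j) →
    x ∈ₗ vertices w′ → x ∈ₗ vertices (w ++ʷ w′)
  ∈-++ʷʳ (stop _) w′ x∈w′ = x∈w′
  ∈-++ʷʳ (step _ w) w′ x∈w′ = there (∈-++ʷʳ w w′ x∈w′)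

  walk-length-positive : ∀ {a b k} → a ≢ b → Walk R a b k → 1 ≤ k
  walk-length-positive a≢b (stop _) = ⊥-elim (a≢b refl)
  walk-length-positive a≢b (step _ _) = s≤s z≤n

  walk-length-one : ∀ {a b} → Walk R a b 1 → R a b
  walk-length-one (step r (stop _)) = r

  walk-preserves : (Z : Fin m → Set) → (∀ {a b} → Z a → R a b → Z b) →
    ∀ {a b k} → Walk R a b k → Z a → Z b
  walk-preserves Z closed (stop _) za = za
  walk-preserves Z closed (step r w) za = walk-preserves Z closed w (closed za r)

  record Split {a b k} (w : Walk R a b k) (x : Fin m) : Set where
    field
      {i j} : ℕ
      prefix : Walk R a x i
      suffix : Walk R x b j
      length-sum : i + j ≡ k
      covers : ∀ y → y ∈ₗ vertices w → y ∈ₗ vertices prefix ⊎ y ∈ₗ vertices suffix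

  splitAt : ∀ {a b k x} (w : Walk R a b k) → x ∈ₗ vertices w → Split w x
  splitAt (stop a) (here refl) = record
    { prefix = stop a ; suffix = stop a ; length-sum = refl ; covers = λ _ → inj₁ }
  splitAt (step r w) (here refl) = record
    { prefix = stop _ ; suffix = step r w ; length-sum = refl ; covers = λ _ → inj₂ }
  splitAt (step r w) (there x∈w) = record
    { prefix = step r prefix ; suffix = suffix ; length-sum = cong suc length-sum
    ; covers = λ { y (here y≡a) → inj₁ (here y≡a) ; y (there y∈w) → Sum.map₁ there (covers y y∈w) } }
    where open Split (splitAt w x∈w)

  NoShorterWalk : Fin m → Fin m → ℕ → Set
  NoShorterWalk a c k = ∀ k′ → Walk R a c k′ → k ≤ k′

  record Between (a b c : Fin m) : Set where
    constructor between
    field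
      {i j} : ℕ
      first : Walk R a b i
      second : Walk R b c j
      shortest : NoShorterWalk a c (i + j)

  between-of-segments : ∀ {u v a b c k p i j q} → NoShorterWalk u v k →
    Walk R u a p → Walk R a b i → Walk R b c j → Walk R c v q → p + (i + (j + q)) ≡ k →
    Between a b c
  between-of-segments {p = p} {i} {j} {q} no-shorter wp wi wj wq refl =
    between wi wj λ L wL → +-cancelˡ-≤ p (i + j) L (+-cancelʳ-≤ q (p + (i + j)) (p + L) (begin
      p + (i + j) + q   ≡⟨ trans (+-assoc p (i + j) q) (cong (p +_) (+-assoc i j q)) ⟩
      p + (i + (j + q)) ≤⟨ no-shorter _ (wp ++ʷ wL ++ʷ wq) ⟩
      p + (L + q)       ≡⟨ +-assoc p L q ⟨
      p + L + q         ∎))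
    where open Data.Nat.Properties.≤-Reasoning

  between-across : ∀ {u v x y z i j} → NoShorterWalk u v (i + j) →
    (A : Walk R u x i) (B : Walk R x v j) → y ∈ₗ vertices A → z ∈ₗ vertices B → Between y x z
  between-across sh A B y∈A z∈B with splitAt A y∈A | splitAt B z∈B
  ... | record { i = p ; j = q ; prefix = A₁ ; suffix = A₂ ; length-sum = refl }
      | record { i = p′ ; j = q′ ; prefix = B₁ ; suffix = B₂ ; length-sum = refl } =
        between-of-segments sh A₁ A₂ B₁ B₂ (sym (+-assoc p q (p′ + q′)))

  between-after : ∀ {u v x y z i j} → NoShorterWalk u v (i + j) →
    (A : Walk R u x i) (B : Walk R x v j) → y ∈ₗ vertices B → z ∈ₗ vertices B →
    Between x y z ⊎ Between x z y
  between-after {i = i} sh A B y∈B z∈B with splitAt B y∈B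
  ... | record { i = p ; j = q ; prefix = B₁ ; suffix = B₂ ; length-sum = refl ; covers = cov }
    with cov _ z∈B
  ...   | inj₁ z∈B₁ with splitAt B₁ z∈B₁
  ...     | record { i = p′ ; j = q′ ; prefix = C₁ ; suffix = C₂ ; length-sum = refl } =
            inj₂ (between-of-segments sh A C₁ C₂ B₂ (cong (i +_) (sym (+-assoc p′ q′ q))))
  between-after sh A B y∈B z∈B | record { prefix = B₁ ; suffix = B₂ ; length-sum = refl } | inj₂ z∈B₂
    with splitAt B₂ z∈B₂
  ...     | record { prefix = C₁ ; suffix = C₂ ; length-sum = refl } =
            inj₁ (between-of-segments sh A B₁ C₁ C₂ refl)

  between-before : ∀ {u v x y z i j} → NoShorterWalk u v (i + j) →
    (A : Walk R u x i) (B : Walk R x v j) → y ∈ₗ vertices A → z ∈ₗ vertices A →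
    Between y z x ⊎ Between z y x
  between-before {j = j} sh A B y∈A z∈A with splitAt A y∈A
  ... | record { i = p ; j = q ; prefix = A₁ ; suffix = A₂ ; length-sum = refl ; covers = cov }
    with cov _ z∈A
  ...   | inj₁ z∈A₁ with splitAt A₁ z∈A₁
  ...     | record { i = p′ ; j = q′ ; prefix = C₁ ; suffix = C₂ ; length-sum = refl } =
            inj₂ (between-of-segments sh C₁ C₂ A₂ B
                    (sym (trans (+-assoc (p′ + q′) q j) (+-assoc p′ q′ (q + j)))))
  between-before {j = j} sh A B y∈A z∈A
    | record { i = p ; prefix = A₁ ; suffix = A₂ ; length-sum = refl } | inj₂ z∈A₂
    with splitAt A₂ z∈A₂
  ...     | record { i = p′ ; j = q′ ; prefix = C₁ ; suffix = C₂ ; length-sum = refl } =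
            inj₁ (between-of-segments sh A₁ C₁ C₂ B
                    (sym (trans (+-assoc p (p′ + q′) j) (cong (p +_) (+-assoc p′ q′ j)))))

  SomeBetween : Fin m → Fin m → Fin m → Set
  SomeBetween x y z =
    Between y x z ⊎ Between z x y ⊎ Between x y z ⊎ Between x z y ⊎ Between y z x ⊎ Between z y x

  between-on-shortest : ∀ {u v k x y z} (w : Walk R u v k) → NoShorterWalk u v k →
    x ∈ₗ vertices w → y ∈ₗ vertices w → z ∈ₗ vertices w → SomeBetween x y z
  between-on-shortest w sh x∈ y∈ z∈ with splitAt w x∈
  ... | record { prefix = A ; suffix = B ; length-sum = refl ; covers = cov } with cov _ y∈ | cov _ z∈
  ...   | inj₁ y∈A | inj₂ z∈B = inj₁ (between-across sh A B y∈A z∈B)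
  ...   | inj₂ y∈B | inj₁ z∈A = inj₂ (inj₁ (between-across sh A B z∈A y∈B))
  ...   | inj₂ y∈B | inj₂ z∈B = inj₂ (inj₂ (Sum.map₂ inj₁ (between-after sh A B y∈B z∈B)))
  ...   | inj₁ y∈A | inj₁ z∈A = inj₂ (inj₂ (inj₂ (inj₂ (between-before sh A B y∈A z∈A))))

mapWalk : ∀ {m m′} {R : Fin m → Fin m → Set} {R′ : Fin m′ → Fin m′ → Set} (f : Fin m → Fin m′) →
  (∀ {a b} → R a b → R′ (f a) (f b)) → ∀ {a b k} → Walk R a b k → Walk R′ (f a) (f b) k
mapWalk f f-hom (stop a) = stop (f a)
mapWalk f f-hom (step r w) = step (f-hom r) (mapWalk f f-hom w)

∈-mapWalk : ∀ {m m′} {R : Fin m → Fin m → Set} {R′ : Fin m′ → Fin m′ → Set} (f : Fin m → Fin m′) →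
  (f-hom : ∀ {a b} → R a b → R′ (f a) (f b)) → ∀ {a b k x} (w : Walk R a b k) →
  x ∈ₗ vertices w → f x ∈ₗ vertices (mapWalk {R′ = R′} f f-hom w)
∈-mapWalk f f-hom (stop a) (here refl) = here refl
∈-mapWalk f f-hom (step r w) (here refl) = here refl
∈-mapWalk f f-hom (step r w) (there x∈w) = there (∈-mapWalk f f-hom w x∈w)

walkWith? : ∀ {m} {R : Fin m → Fin m → Set} → Decidable R →
  (P : List (Fin m) → Set) → (∀ vs → Dec (P vs)) →
  ∀ k u v → Dec (Σ (Walk R u v k) (P ∘ vertices))
walkWith? R? P P? zero u v with u ≟ v
... | no u≢v = no λ { (stop _ , _) → u≢v refl }
... | yes refl = map′ (stop u ,_) (λ { (stop _ , p) → p }) (P? (u ∷ []))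
walkWith? R? P P? (suc k) u v =
  map′ (λ { (_ , r , w , p) → step r w , p }) (λ { (step r w , p) → _ , r , w , p })
    (any? λ u′ → R? u u′ ×-dec walkWith? R? (P ∘ (u ∷_)) (P? ∘ (u ∷_)) k u′ v)

module SimpleGraph {G : Graph} (simple : IsSimple G) where

  irrefl : ∀ {g} → ¬ Adj G g g
  irrefl {g} = subst T (proj₂ simple g)

  sym-adj : ∀ {a b} → Adj G a b → Adj G b a
  sym-adj {a} {b} = subst T (proj₁ simple a b)

  adj⇒≢ : ∀ {a b} → Adj G a b → a ≢ b
  adj⇒≢ a~b refl = irrefl a~b

has-neighbour : (G : Graph) → Nontrivial G → Connected G → ∀ g → ∃ (Adj G g)
has-neighbour G nontrivial connected g with another-vertex nontrivial g
  where
  another-vertex : ∀ {m} → 2 ≤ m → (g : Fin m) → ∃ λ g′ → g ≢ g′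
  another-vertex (s≤s (s≤s _)) Fin.zero = Fin.suc Fin.zero , λ ()
  another-vertex (s≤s (s≤s _)) (Fin.suc g) = Fin.zero , λ ()
... | g′ , g≢g′ with connected g g′
...   | _ , stop _ = ⊥-elim (g≢g′ refl)
...   | _ , step g~g″ _ = _ , g~g″

adjacent-path-is-geodesic : (G : Graph) → ∀ {x y z} → x ≢ z → ¬ Adj G x z →
  Adj G x y → Adj G y z → OnCommonGeodesic G x y z
adjacent-path-is-geodesic G x≢z x≁z x~y y~z =
  _ , _ , 2 , step x~y (step y~z (stop _)) , no-shorter ,
  here refl , there (here refl) , there (there (here refl))
  where
  no-shorter : ∀ k → Walk (Adj G) _ _ k → 2 ≤ k
  no-shorter _ (stop _) = ⊥-elim (x≢z refl)
  no-shorter _ (step x~z (stop _)) = ⊥-elim (x≁z x~z)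
  no-shorter _ (step _ (step _ _)) = s≤s (s≤s z≤n)

module ConnectedGraph (G : Graph) (connected : Connected G) where

  open import Data.List.Membership.DecPropositional (_≟_ {n G}) using (_∈?_)

  walk? : ∀ u v k → Dec (Walk (Adj G) u v k)
  walk? u v k = map′ proj₁ (_, _) (walkWith? (λ a b → T? (E G a b)) (λ _ → ⊤) (λ _ → yes tt) k u v)

  GeodesicThrough : (x y z u v : Fin (n G)) → Set
  GeodesicThrough x y z u v = Σ ℕ λ k → Σ (Walk (Adj G) u v k) λ w →
    IsShortest G w × x ∈ₗ vertices w × y ∈ₗ vertices w × z ∈ₗ vertices w

  -- A geodesic from u to v is no longer than the walk supplied by connectivity, which bounds the search.
  geodesicThrough? : ∀ x y z u v → Dec (GeodesicThrough x y z u v)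
  geodesicThrough? x y z u v =
    map′ (λ { (k , _ , no-shorter , w , through) → k , w , shortest {w = w} no-shorter , through })
         (λ { (k , w , sh , through) →
                k , s≤s (sh _ (proj₂ (connected u v))) , (λ {k′} k′<k w′ → <⇒≱ k′<k (sh k′ w′)) , w , through })
         (anyUpTo? (λ k → allUpTo? (λ k′ → ¬? (walk? u v k′)) k ×-dec
                          walkWith? (λ a b → T? (E G a b)) Through through? k u v)
                   (suc (proj₁ (connected u v))))
    where
    Through : List (Fin (n G)) → Set
    Through vs = x ∈ₗ vs × y ∈ₗ vs × z ∈ₗ vs
    through? : ∀ vs → Dec (Through vs)
    through? vs = (x ∈? vs) ×-dec (y ∈? vs) ×-dec (z ∈? vs)
    shortest : ∀ {k} {w : Walk (Adj G) u v k} → (∀ {k′} → k′ < k → ¬ Walk (Adj G) u v k′) → IsShortest G w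
    shortest {k} no-shorter k′ w′ with k ≤? k′
    ... | yes k≤k′ = k≤k′
    ... | no k≰k′ = ⊥-elim (no-shorter (≰⇒> k≰k′) w′)

  onCommonGeodesic? : ∀ x y z → Dec (OnCommonGeodesic G x y z)
  onCommonGeodesic? x y z = any? λ u → any? λ v → geodesicThrough? x y z u v

  isGPSet? : ∀ S → Dec (IsGPSet G S)
  isGPSet? S = all? λ x → all? λ y → all? λ z →
    x ∈ₛ? S →-dec y ∈ₛ? S →-dec z ∈ₛ? S →-dec
    ¬? (x ≟ y) →-dec ¬? (y ≟ z) →-dec ¬? (x ≟ z) →-dec ¬? (onCommonGeodesic? x y z)

indicator : ∀ {m} → Subset m → Fin m → ℕ
indicator p i = if lookup p i then 1 else 0

indicator-∈ : ∀ {m} {p : Subset m} {x} → x ∈ p → indicator p x ≡ 1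
indicator-∈ x∈p rewrite []=⇒lookup x∈p = refl

indicator-∉ : ∀ {m} {p : Subset m} {x} → x ∉ p → indicator p x ≡ 0
indicator-∉ {p = p} {x} x∉p with lookup p x in eq
... | true = ⊥-elim (x∉p (lookup⇒[]= x p eq))
... | false = refl

∣p∣≡∑indicator : ∀ {m} (p : Subset m) → ∣ p ∣ ≡ sum (indicator p)
∣p∣≡∑indicator [] = refl
∣p∣≡∑indicator (inside ∷ p) = cong suc (∣p∣≡∑indicator p)
∣p∣≡∑indicator (outside ∷ p) = ∣p∣≡∑indicator p

∣tabulate∣≡∑ : ∀ {m} (f : Fin m → Bool) → ∣ tabulate f ∣ ≡ sum (λ i → if f i then 1 else 0)
∣tabulate∣≡∑ f = trans (∣p∣≡∑indicator (tabulate f)) (sum-cong-≗ (λ i → cong (if_then 1 else 0) (lookup∘tabulate f i)))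

∣p∣*c≡∑ : ∀ {m} (p : Subset m) c → ∣ p ∣ * c ≡ sum (λ i → indicator p i * c)
∣p∣*c≡∑ p c = trans (cong (_* c) (∣p∣≡∑indicator p)) (*-distribʳ-sum c (indicator p))

sum-mono-≤ : ∀ {m} {f g : Fin m → ℕ} → (∀ i → f i ≤ g i) → sum f ≤ sum g
sum-mono-≤ {zero} _ = z≤n
sum-mono-≤ {suc m} f≤g = +-mono-≤ (f≤g Fin.zero) (sum-mono-≤ (f≤g ∘ Fin.suc))

sum-↑ : ∀ m {k} (φ : Fin (m + k) → ℕ) → sum φ ≡ sum (φ ∘ (_↑ˡ k)) + sum (φ ∘ (m ↑ʳ_))
sum-↑ zero φ = refl
sum-↑ (suc m) φ = trans (cong (φ Fin.zero +_) (sum-↑ m (φ ∘ Fin.suc))) (sym (+-assoc (φ Fin.zero) _ _))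

sum-combine : ∀ N M (φ : Fin (N * M) → ℕ) → sum φ ≡ sum λ g → sum λ h → φ (combine {N} {M} g h)
sum-combine zero M φ = refl
sum-combine (suc N) M φ = trans (sum-↑ M φ) (cong (sum (φ ∘ (_↑ˡ N * M)) +_) (sum-combine N M (φ ∘ (M ↑ʳ_))))

∈⇒T-lookup : ∀ {m} {p : Subset m} {x} → x ∈ p → T (lookup p x)
∈⇒T-lookup x∈p = subst T (sym ([]=⇒lookup x∈p)) tt

T-lookup⇒∈ : ∀ {m} {p : Subset m} {x} → T (lookup p x) → x ∈ p
T-lookup⇒∈ {p = p} {x} t with lookup p x in eq
... | true = lookup⇒[]= x p eq

∈-tabulate⁺ : ∀ {m} {f : Fin m → Bool} {x} → T (f x) → x ∈ tabulate f
∈-tabulate⁺ {f = f} {x} t = T-lookup⇒∈ (subst T (sym (lookup∘tabulate f x)) t)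

∈-tabulate⁻ : ∀ {m} {f : Fin m → Bool} {x} → x ∈ tabulate f → T (f x)
∈-tabulate⁻ {f = f} {x} x∈ = subst T (lookup∘tabulate f x) (∈⇒T-lookup x∈)

module ProductIndex (N M : ℕ) where

  π₁ : Fin (N * M) → Fin N
  π₁ x = proj₁ (remQuot {N} M x)

  π₂ : Fin (N * M) → Fin M
  π₂ x = proj₂ (remQuot {N} M x)

  ⟨_,_⟩ : Fin N → Fin M → Fin (N * M)
  ⟨_,_⟩ = combine

  π₁-⟨⟩ : ∀ g h → π₁ ⟨ g , h ⟩ ≡ g
  π₁-⟨⟩ g h = cong proj₁ (remQuot-combine g h)

  π₂-⟨⟩ : ∀ g h → π₂ ⟨ g , h ⟩ ≡ h
  π₂-⟨⟩ g h = cong proj₂ (remQuot-combine g h)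

  ⟨π₁,π₂⟩ : ∀ x → ⟨ π₁ x , π₂ x ⟩ ≡ x
  ⟨π₁,π₂⟩ x = combine-remQuot {N} M x

  π-injective : ∀ {x y} → π₁ x ≡ π₁ y → π₂ x ≡ π₂ y → x ≡ y
  π-injective {x} {y} e₁ e₂ = trans (sym (⟨π₁,π₂⟩ x)) (trans (cong₂ ⟨_,_⟩ e₁ e₂) (⟨π₁,π₂⟩ y))

  ⟨⟩-≢-base : ∀ {g g′ h h′} → g ≢ g′ → ⟨ g , h ⟩ ≢ ⟨ g′ , h′ ⟩
  ⟨⟩-≢-base g≢g′ e = g≢g′ (trans (sym (π₁-⟨⟩ _ _)) (trans (cong π₁ e) (π₁-⟨⟩ _ _)))

  ⟨⟩-≢-fibre : ∀ {g g′ h h′} → h ≢ h′ → ⟨ g , h ⟩ ≢ ⟨ g′ , h′ ⟩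
  ⟨⟩-≢-fibre h≢h′ e = h≢h′ (trans (sym (π₂-⟨⟩ _ _)) (trans (cong π₂ e) (π₂-⟨⟩ _ _)))

  fibre : Subset (N * M) → Fin N → Subset M
  fibre X g = tabulate λ h → lookup X ⟨ g , h ⟩

  ∈-fibre⁻ : ∀ {X g h} → h ∈ fibre X g → ⟨ g , h ⟩ ∈ X
  ∈-fibre⁻ ∈fibre = T-lookup⇒∈ (∈-tabulate⁻ ∈fibre)

  fromFibres : (Fin N → Subset M) → Subset (N * M)
  fromFibres Φ = tabulate λ x → lookup (Φ (π₁ x)) (π₂ x)

  ∈-fromFibres⁻ : ∀ {Φ x} → x ∈ fromFibres Φ → π₂ x ∈ Φ (π₁ x)
  ∈-fromFibres⁻ ∈X = T-lookup⇒∈ (∈-tabulate⁻ ∈X)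

  fibre-fromFibres : ∀ Φ g → fibre (fromFibres Φ) g ≡ Φ g
  fibre-fromFibres Φ g = begin
    tabulate (λ h → lookup (fromFibres Φ) ⟨ g , h ⟩)
      ≡⟨ tabulate-cong (λ h → lookup∘tabulate _ ⟨ g , h ⟩) ⟩
    tabulate (λ h → lookup (Φ (π₁ ⟨ g , h ⟩)) (π₂ ⟨ g , h ⟩))
      ≡⟨ tabulate-cong (λ h → cong₂ (λ g′ h′ → lookup (Φ g′) h′) (π₁-⟨⟩ g h) (π₂-⟨⟩ g h)) ⟩
    tabulate (lookup (Φ g))
      ≡⟨ tabulate∘lookup (Φ g) ⟩
    Φ g ∎
    where open ≡-Reasoning

  ∣X∣≡∑∣fibre∣ : ∀ X → ∣ X ∣ ≡ sum λ g → ∣ fibre X g ∣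
  ∣X∣≡∑∣fibre∣ X = begin
    ∣ X ∣                                           ≡⟨ ∣p∣≡∑indicator X ⟩
    sum (indicator X)                               ≡⟨ sum-combine N M (indicator X) ⟩
    sum (λ g → sum λ h → indicator X ⟨ g , h ⟩)
      ≡⟨ sum-cong-≗ (λ g → sym (∣tabulate∣≡∑ (λ h → lookup X ⟨ g , h ⟩))) ⟩
    sum (λ g → ∣ fibre X g ∣)                       ∎
    where open ≡-Reasoning

module Lexicographic (G H : Graph) (simpleG : IsSimple G) (simpleH : IsSimple H) where

  private
    N = n G
    M = n H
    module SG = SimpleGraph simpleG
    module SH = SimpleGraph simpleH

  open ProductIndex N M public

  LG : Graph
  LG = lex G H

  E-lex : ∀ x y → E LG x y ≡ (E G (π₁ x) (π₁ y) ∨ (⌊ π₁ x ≟ π₁ y ⌋ ∧ E H (π₂ x) (π₂ y)))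
  E-lex x y with remQuot {N} M x | remQuot {N} M y
  ... | _ | _ = refl

  adj-lex⁻ : ∀ {x y} → Adj LG x y → Adj G (π₁ x) (π₁ y) ⊎ (π₁ x ≡ π₁ y × Adj H (π₂ x) (π₂ y))
  adj-lex⁻ {x} {y} x~y with Equivalence.to T-∨ (subst T (E-lex x y) x~y)
  ... | inj₁ base = inj₁ base
  ... | inj₂ fibre with Equivalence.to T-∧ fibre
  ...   | same , adj = inj₂ (toWitness same , adj)

  adj-lex-base : ∀ {x y} → Adj G (π₁ x) (π₁ y) → Adj LG x y
  adj-lex-base {x} {y} base = subst T (sym (E-lex x y)) (Equivalence.from T-∨ (inj₁ base))

  adj-lex-fibre : ∀ {x y} → π₁ x ≡ π₁ y → Adj H (π₂ x) (π₂ y) → Adj LG x y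
  adj-lex-fibre {x} {y} same adj = subst T (sym (E-lex x y))
    (Equivalence.from (T-∨ {E G (π₁ x) (π₁ y)})
      (inj₂ (Equivalence.from T-∧ (fromWitness {a? = π₁ x ≟ π₁ y} same , adj))))

  ⟨⟩-adj-base : ∀ {g g′ h h′} → Adj G g g′ → Adj LG ⟨ g , h ⟩ ⟨ g′ , h′ ⟩
  ⟨⟩-adj-base g~g′ = adj-lex-base (subst₂ (Adj G) (sym (π₁-⟨⟩ _ _)) (sym (π₁-⟨⟩ _ _)) g~g′)

  ⟨⟩-adj-fibre : ∀ {g h h′} → Adj H h h′ → Adj LG ⟨ g , h ⟩ ⟨ g , h′ ⟩
  ⟨⟩-adj-fibre h~h′ = adj-lex-fibre (trans (π₁-⟨⟩ _ _) (sym (π₁-⟨⟩ _ _)))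
    (subst₂ (Adj H) (sym (π₂-⟨⟩ _ _)) (sym (π₂-⟨⟩ _ _)) h~h′)

  ⟨⟩-nonadj-fibre : ∀ {g h h′} → ¬ Adj H h h′ → ¬ Adj LG ⟨ g , h ⟩ ⟨ g , h′ ⟩
  ⟨⟩-nonadj-fibre {g} {h} {h′} h≁h′ x~y with adj-lex⁻ x~y
  ... | inj₁ base = SG.irrefl (subst₂ (Adj G) (π₁-⟨⟩ g h) (π₁-⟨⟩ g h′) base)
  ... | inj₂ (_ , adj) = h≁h′ (subst₂ (Adj H) (π₂-⟨⟩ g h) (π₂-⟨⟩ g h′) adj)

  record Projection {a b k} (g : Fin N) (w : Walk (Adj LG) a b k) : Set where
    field
      {len} : ℕ
      len≤ : len ≤ k
      walk : Walk (Adj G) g (π₁ b) len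
      covers : ∀ y → y ∈ₗ vertices w → π₁ y ∈ₗ vertices walk

  projectFrom : ∀ {a b k g} → g ≡ π₁ a → (w : Walk (Adj LG) a b k) → Projection g w
  projectFrom refl (stop a) = record
    { len≤ = z≤n ; walk = stop (π₁ a) ; covers = λ { y (here refl) → here refl } }
  projectFrom {g = g} g≡ (step a~c w) with adj-lex⁻ a~c
  ... | inj₁ base = record
    { len≤ = s≤s len≤ ; walk = step (subst (λ t → Adj G t _) (sym g≡) base) walk
    ; covers = λ { y (here refl) → here (sym g≡) ; y (there y∈w) → there (covers y y∈w) } }
    where open Projection (projectFrom refl w)
  ... | inj₂ (same , _) = record
    { len≤ = m≤n⇒m≤1+n len≤ ; walk = walk
    ; covers = λ { y (here refl) → subst (_∈ₗ vertices walk) g≡ (start∈vertices walk)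
                 ; y (there y∈w) → covers y y∈w } }
    where open Projection (projectFrom (trans g≡ same) w)

  project : ∀ {a b k} (w : Walk (Adj LG) a b k) → Projection (π₁ a) w
  project = projectFrom refl

  liftWalk : (f : Fin N → Fin M) → ∀ {a b k} → Walk (Adj G) a b k →
    Walk (Adj LG) ⟨ a , f a ⟩ ⟨ b , f b ⟩ k
  liftWalk f = mapWalk (λ g → ⟨ g , f g ⟩) ⟨⟩-adj-base

  ∈-liftWalk : (f : Fin N → Fin M) → ∀ {a b k g} (w : Walk (Adj G) a b k) →
    g ∈ₗ vertices w → ⟨ g , f g ⟩ ∈ₗ vertices (liftWalk f w)
  ∈-liftWalk f = ∈-mapWalk (λ g → ⟨ g , f g ⟩) ⟨⟩-adj-base

  liftWalk-shortest : (f : Fin N → Fin M) → ∀ {a b k} (w : Walk (Adj G) a b k) →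
    IsShortest G w → IsShortest LG (liftWalk f w)
  liftWalk-shortest f {a} {b} w shortest k′ w′ =
    ≤-trans (shortest len (subst₂ (λ s t → Walk (Adj G) s t len) (π₁-⟨⟩ a (f a)) (π₁-⟨⟩ b (f b)) walk))
            len≤
    where open Projection (project w′)

  liftWalk-between : ∀ {x y k} → π₁ x ≢ π₁ y → Walk (Adj G) (π₁ x) (π₁ y) k → Walk (Adj LG) x y k
  liftWalk-between {x} {y} x≢y w = subst₂ (λ a b → Walk (Adj LG) a b _) at-x at-y (liftWalk f w)
    where
    f : Fin N → Fin M
    f = updateAt (λ _ → π₂ y) (π₁ x) (λ _ → π₂ x)
    at-x : ⟨ π₁ x , f (π₁ x) ⟩ ≡ x
    at-x = trans (cong ⟨ π₁ x ,_⟩ (updateAt-updates (π₁ x) (λ _ → π₂ y))) (⟨π₁,π₂⟩ x)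
    at-y : ⟨ π₁ y , f (π₁ y) ⟩ ≡ y
    at-y = trans (cong ⟨ π₁ y ,_⟩ (updateAt-minimal (π₁ y) (π₁ x) (λ _ → π₂ y) (x≢y ∘ sym))) (⟨π₁,π₂⟩ y)

  BetweenLG : Fin (N * M) → Fin (N * M) → Fin (N * M) → Set
  BetweenLG = Between {R = Adj LG}

  middle-base≢start-base : ∀ {a b c} → BetweenLG a b c → π₁ a ≢ π₁ c → a ≢ b → π₁ b ≢ π₁ a
  middle-base≢start-base (between wab wbc shortest) bases-differ a≢b same =
    positive-summand (walk-length-positive a≢b wab)
      (≤-trans (shortest _ (liftWalk-between bases-differ walk)) len≤)
    where open Projection (projectFrom (sym same) wbc)

  middle-base≢end-base : ∀ {a b c} → BetweenLG a b c → π₁ a ≢ π₁ c → b ≢ c → π₁ b ≢ π₁ c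
  middle-base≢end-base {a} (between {i} {j} wab wbc shortest) bases-differ b≢c same =
    positive-summand (walk-length-positive b≢c wbc) (begin
      j + i  ≡⟨ +-comm j i ⟩
      i + j  ≤⟨ shortest _ (liftWalk-between bases-differ (subst (λ t → Walk (Adj G) (π₁ a) t _) same walk)) ⟩
      len    ≤⟨ len≤ ⟩
      i      ∎)
    where
    open Projection (project wab)
    open Data.Nat.Properties.≤-Reasoning

  between-projects-to-geodesic : ∀ {a b c} → BetweenLG a b c → π₁ a ≢ π₁ c →
    OnCommonGeodesic G (π₁ a) (π₁ b) (π₁ c)
  between-projects-to-geodesic (between wab wbc shortest) bases-differ =
    _ , _ , _ , walk , (λ L wL → ≤-trans len≤ (shortest L (liftWalk-between bases-differ wL))) ,
    covers _ (start∈vertices _) , covers _ (∈-++ʷʳ wab wbc (start∈vertices wbc)) , covers _ (end∈vertices _)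
    where open Projection (project (wab ++ʷ wbc))

  module _ (neighbour : ∀ g → ∃ (Adj G g)) where

    walk-within-base : ∀ {x y} → π₁ x ≡ π₁ y → Walk (Adj LG) x y 2
    walk-within-base {x} {y} same = step (adj-lex-base x~z) (step (adj-lex-base z~y) (stop y))
      where
      g′ = proj₁ (neighbour (π₁ x))
      z = ⟨ g′ , π₂ x ⟩
      x~z : Adj G (π₁ x) (π₁ z)
      x~z = subst (Adj G (π₁ x)) (sym (π₁-⟨⟩ g′ (π₂ x))) (proj₂ (neighbour (π₁ x)))
      z~y : Adj G (π₁ z) (π₁ y)
      z~y = subst₂ (Adj G) (sym (π₁-⟨⟩ g′ (π₂ x))) same (SG.sym-adj (proj₂ (neighbour (π₁ x))))

    between-same-base : ∀ {a b c} → BetweenLG a b c → π₁ a ≡ π₁ c → a ≢ b → b ≢ c →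
      ¬ Adj LG a c × Adj LG a b × Adj LG b c
    between-same-base {a} {b} {c} (between {i} {j} wab wbc shortest) same a≢b b≢c =
      a≁c , walk-length-one (subst (Walk (Adj LG) a b) i≡1 wab) ,
      walk-length-one (subst (Walk (Adj LG) b c) j≡1 wbc)
      where
      i≥1 = walk-length-positive a≢b wab
      j≥1 = walk-length-positive b≢c wbc
      a≁c : ¬ Adj LG a c
      a≁c a~c = 1+n≰n (≤-trans (+-mono-≤ i≥1 j≥1) (shortest 1 (step a~c (stop c))))
      lengths : i ≡ 1 × j ≡ 1
      lengths = both-one i≥1 j≥1 (shortest 2 (walk-within-base same))
      i≡1 = proj₁ lengths
      j≡1 = proj₂ lengths

∣⁅x⁆∪⁅y⁆∣≡2 : ∀ {m} {x y : Fin m} → x ≢ y → ∣ ⁅ x ⁆ ∪ ⁅ y ⁆ ∣ ≡ 2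
∣⁅x⁆∪⁅y⁆∣≡2 {x = Fin.zero} {y = Fin.zero} x≢y = ⊥-elim (x≢y refl)
∣⁅x⁆∪⁅y⁆∣≡2 {x = Fin.zero} {y = Fin.suc y} _ = cong suc (trans (cong ∣_∣ (∪-identityˡ ⁅ y ⁆)) (∣⁅x⁆∣≡1 y))
∣⁅x⁆∪⁅y⁆∣≡2 {x = Fin.suc x} {y = Fin.zero} _ = cong suc (trans (cong ∣_∣ (∪-identityʳ ⁅ x ⁆)) (∣⁅x⁆∣≡1 x))
∣⁅x⁆∪⁅y⁆∣≡2 {x = Fin.suc x} {y = Fin.suc y} x≢y = ∣⁅x⁆∪⁅y⁆∣≡2 (x≢y ∘ cong Fin.suc)

x∈⁅x⁆∪⁅y⁆ : ∀ {m} (x y : Fin m) → x ∈ ⁅ x ⁆ ∪ ⁅ y ⁆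
x∈⁅x⁆∪⁅y⁆ x y = x∈p∪q⁺ (inj₁ (x∈⁅x⁆ x))

y∈⁅x⁆∪⁅y⁆ : ∀ {m} (x y : Fin m) → y ∈ ⁅ x ⁆ ∪ ⁅ y ⁆
y∈⁅x⁆∪⁅y⁆ x y = x∈p∪q⁺ {p = ⁅ x ⁆} (inj₂ (x∈⁅x⁆ y))

∈⁅x⁆∪⁅y⁆⁻ : ∀ {m} {z} (x y : Fin m) → z ∈ ⁅ x ⁆ ∪ ⁅ y ⁆ → z ≡ x ⊎ z ≡ y
∈⁅x⁆∪⁅y⁆⁻ x y z∈ = Sum.map (x∈⁅y⁆⇒x≡y x) (x∈⁅y⁆⇒x≡y y) (x∈p∪q⁻ ⁅ x ⁆ ⁅ y ⁆ z∈)

private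
  ∣p∣≡0⇒empty : ∀ {m} (p : Subset m) → ∣ p ∣ ≡ 0 → ∀ x → x ∉ p
  ∣p∣≡0⇒empty (outside ∷ p) e (Fin.suc x) (there x∈p) = ∣p∣≡0⇒empty p e x x∈p

  ∣p∣≡1⇒singleton : ∀ {m} (p : Subset m) → ∣ p ∣ ≡ 1 → ∃ λ x → x ∈ p × (∀ z → z ∈ p → z ≡ x)
  ∣p∣≡1⇒singleton (inside ∷ p) e = Fin.zero , here ,
    λ { Fin.zero _ → refl ; (Fin.suc z) (there z∈p) → ⊥-elim (∣p∣≡0⇒empty p (suc-injective e) z z∈p) }
  ∣p∣≡1⇒singleton (outside ∷ p) e with ∣p∣≡1⇒singleton p e
  ... | x , x∈p , unique = Fin.suc x , there x∈p , λ { (Fin.suc z) (there z∈p) → cong Fin.suc (unique z z∈p) }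

∣p∣≡2⇒pair : ∀ {m} (p : Subset m) → ∣ p ∣ ≡ 2 →
  ∃₂ λ x y → x ≢ y × x ∈ p × y ∈ p × (∀ z → z ∈ p → z ≡ x ⊎ z ≡ y)
∣p∣≡2⇒pair (inside ∷ p) e with ∣p∣≡1⇒singleton p (suc-injective e)
... | y , y∈p , unique = Fin.zero , Fin.suc y , (λ ()) , here , there y∈p ,
  λ { Fin.zero _ → inj₁ refl ; (Fin.suc z) (there z∈p) → inj₂ (cong Fin.suc (unique z z∈p)) }
∣p∣≡2⇒pair (outside ∷ p) e with ∣p∣≡2⇒pair p e
... | x , y , x≢y , x∈p , y∈p , pair =
  Fin.suc x , Fin.suc y , x≢y ∘ Data.Fin.Properties.suc-injective , there x∈p , there y∈p ,
  λ { (Fin.suc z) (there z∈p) → Sum.map (cong Fin.suc) (cong Fin.suc) (pair z z∈p) }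

Joins : ∀ {m} → Fin m × Fin m → Fin m → Fin m → Set
Joins (p , q) x y = (x ≡ p × y ≡ q) ⊎ (x ≡ q × y ≡ p)

joins-same-edge : ∀ {m} {e : Fin m × Fin m} {x y x′ y′} → Joins e x y → Joins e x′ y′ →
  (x ≡ x′ × y ≡ y′) ⊎ (x ≡ y′ × y ≡ x′)
joins-same-edge (inj₁ (refl , refl)) (inj₁ (refl , refl)) = inj₁ (refl , refl)
joins-same-edge (inj₁ (refl , refl)) (inj₂ (refl , refl)) = inj₂ (refl , refl)
joins-same-edge (inj₂ (refl , refl)) (inj₁ (refl , refl)) = inj₂ (refl , refl)
joins-same-edge (inj₂ (refl , refl)) (inj₂ (refl , refl)) = inj₁ (refl , refl)

edge-index : ∀ {m} {F : List (Fin m × Fin m)} {x y} → EdgeRel F x y →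
  Σ (Fin (length F)) λ i → Joins (List.lookup F i) x y
edge-index (inj₁ xy∈F) = index xy∈F , forward (lookup-index xy∈F)
  where
  forward : ∀ {e x y} → (x , y) ≡ e → Joins e x y
  forward refl = inj₁ (refl , refl)
edge-index (inj₂ yx∈F) = index yx∈F , backward (lookup-index yx∈F)
  where
  backward : ∀ {e x y} → (y , x) ≡ e → Joins e x y
  backward refl = inj₂ (refl , refl)

fin-≤1-unique : ∀ {n} → n ≤ 1 → (i j : Fin n) → i ≡ j
fin-≤1-unique (s≤s z≤n) Fin.zero Fin.zero = refl

pigeonhole₃ : ∀ {n} → n ≤ 2 → (i j k : Fin n) → i ≡ j ⊎ i ≡ k ⊎ j ≡ k
pigeonhole₃ _ Fin.zero Fin.zero _ = inj₁ refl
pigeonhole₃ n≤2 (Fin.suc i) (Fin.suc j) _ = inj₁ (cong Fin.suc (fin-≤1-unique (≤-pred n≤2) i j))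
pigeonhole₃ _ Fin.zero (Fin.suc _) Fin.zero = inj₂ (inj₁ refl)
pigeonhole₃ _ (Fin.suc _) Fin.zero Fin.zero = inj₂ (inj₂ refl)
pigeonhole₃ n≤2 Fin.zero (Fin.suc j) (Fin.suc k) = inj₂ (inj₂ (cong Fin.suc (fin-≤1-unique (≤-pred n≤2) j k)))
pigeonhole₃ n≤2 (Fin.suc i) Fin.zero (Fin.suc k) = inj₂ (inj₁ (cong Fin.suc (fin-≤1-unique (≤-pred n≤2) i k)))

module _ {m : ℕ} {F : List (Fin m × Fin m)} where

  walk-in-≤1-edges : length F ≤ 1 → ∀ {a b k} → Walk (EdgeRel F) a b k → a ≡ b ⊎ EdgeRel F a b
  walk-in-≤1-edges F≤1 {a} w = Sum.map₁ sym (walk-preserves Z closed w (inj₁ refl))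
    where
    Z : Fin m → Set
    Z t = t ≡ a ⊎ EdgeRel F a t
    closed : ∀ {t y} → Z t → EdgeRel F t y → Z y
    closed (inj₁ refl) t~y = inj₂ t~y
    closed (inj₂ a~t) t~y with edge-index a~t | edge-index t~y
    ... | i , a-t | i′ , t-y with fin-≤1-unique F≤1 i i′
    ...   | refl with joins-same-edge a-t t-y
    ...     | inj₁ (refl , refl) = inj₁ refl
    ...     | inj₂ (refl , _) = inj₁ refl

  -- The ball of radius two around a is closed under edges: the three edges a – c, c – t, t – y
  -- of a graph with two edges cannot be pairwise distinct.
  walk-in-≤2-edges : length F ≤ 2 → ∀ {a b k} → Walk (EdgeRel F) a b k →
    a ≡ b ⊎ EdgeRel F a b ⊎ ∃ λ c → EdgeRel F a c × EdgeRel F c b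
  walk-in-≤2-edges F≤2 {a} w = Sum.map₁ sym (walk-preserves Z closed w (inj₁ refl))
    where
    Z : Fin m → Set
    Z t = t ≡ a ⊎ EdgeRel F a t ⊎ ∃ λ c → EdgeRel F a c × EdgeRel F c t
    closed : ∀ {t y} → Z t → EdgeRel F t y → Z y
    closed (inj₁ refl) t~y = inj₂ (inj₁ t~y)
    closed (inj₂ (inj₁ a~t)) t~y = inj₂ (inj₂ (_ , a~t , t~y))
    closed (inj₂ (inj₂ (c , a~c , c~t))) t~y
      with edge-index a~c | edge-index c~t | edge-index t~y
    ... | i , a-c | i′ , c-t | i″ , t-y with pigeonhole₃ F≤2 i i′ i″
    ...   | inj₁ refl with joins-same-edge a-c c-t
    ...     | inj₁ (refl , refl) = inj₂ (inj₁ t~y)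
    ...     | inj₂ (refl , _) = inj₂ (inj₁ t~y)
    closed (inj₂ (inj₂ (c , a~c , c~t))) t~y | i , a-c | _ , c-t | _ , t-y | inj₂ (inj₁ refl)
      with joins-same-edge a-c t-y
    ...     | inj₁ (refl , refl) = inj₂ (inj₁ a~c)
    ...     | inj₂ (refl , _) = inj₁ refl
    closed (inj₂ (inj₂ (c , a~c , c~t))) t~y | _ , a-c | i , c-t | _ , t-y | inj₂ (inj₂ refl)
      with joins-same-edge c-t t-y
    ...     | inj₁ (refl , refl) = inj₂ (inj₁ a~c)
    ...     | inj₂ (refl , _) = inj₂ (inj₁ a~c)

record InducedP3 (H : Graph) (A : Subset (n H)) : Set where
  constructor inducedP3
  field
    {x y z} : Fin (n H)
    x∈A : x ∈ A
    y∈A : y ∈ A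
    z∈A : z ∈ A
    x≢z : x ≢ z
    x~y : Adj H x y
    y~z : Adj H y z
    x≁z : ¬ Adj H x z

module JoinCritical {H : Graph} (simpleH : IsSimple H) where

  open SimpleGraph simpleH

  private
    Edges = List (Fin (n H) × Fin (n H))

  module _ {A W U : Subset (n H)} {F : Edges} (connector : IsConnSubgraphContaining H A W U F) where

    connector-adj : ∀ {a b} → EdgeRel F a b → Adj H a b
    connector-adj (inj₁ ab∈F) = proj₁ (proj₁ (proj₂ (proj₂ connector)) _ _ ab∈F)
    connector-adj (inj₂ ba∈F) = sym-adj (proj₁ (proj₁ (proj₂ (proj₂ connector)) _ _ ba∈F))

    connector-endpoint : ∀ {a b} → EdgeRel F a b → b ∈ U
    connector-endpoint (inj₁ ab∈F) = proj₂ (proj₂ (proj₁ (proj₂ (proj₂ connector)) _ _ ab∈F))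
    connector-endpoint (inj₂ ba∈F) = proj₁ (proj₂ (proj₁ (proj₂ (proj₂ connector)) _ _ ba∈F))

    connector-walk : ∀ {a b} → a ∈ W → b ∈ W → ∃ (Walk (EdgeRel F) a b)
    connector-walk a∈W b∈W = proj₂ (proj₂ (proj₂ connector)) _ _ (W⊆U a∈W) (W⊆U b∈W)
      where W⊆U = proj₁ (proj₂ connector)

    connector-has-two-edges : ∀ {x z} → x ∈ W → z ∈ W → x ≢ z → ¬ Adj H x z → 2 ≤ length F
    connector-has-two-edges x∈W z∈W x≢z x≁z with 2 ≤? length F
    ... | yes F≥2 = F≥2
    ... | no F≱2 with walk-in-≤1-edges (≤-pred (≰⇒> F≱2)) (proj₂ (connector-walk x∈W z∈W))
    ...   | inj₁ x≡z = ⊥-elim (x≢z x≡z)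
    ...   | inj₂ x~z = ⊥-elim (x≁z (connector-adj x~z))

  path-connector : ∀ {A x y z} → x ∈ A → y ∈ A → z ∈ A → Adj H x y → Adj H y z →
    IsConnSubgraphContaining H A (⁅ x ⁆ ∪ ⁅ z ⁆) (⁅ y ⁆ ∪ (⁅ x ⁆ ∪ ⁅ z ⁆)) ((x , y) ∷ (y , z) ∷ [])
  path-connector {A} {x} {y} {z} x∈A y∈A z∈A x~y y~z =
    U⊆A , B⊆U , edges , λ a b a∈U b∈U → _ , proj₂ (to-y a∈U) ++ʷ proj₂ (from-y b∈U)
    where
    B = ⁅ x ⁆ ∪ ⁅ z ⁆
    U = ⁅ y ⁆ ∪ B
    F : Edges
    F = (x , y) ∷ (y , z) ∷ []
    ∈U⁻ : ∀ {t} → t ∈ U → t ≡ y ⊎ t ≡ x ⊎ t ≡ z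
    ∈U⁻ t∈U = Sum.map (x∈⁅y⁆⇒x≡y y) (∈⁅x⁆∪⁅y⁆⁻ x z) (x∈p∪q⁻ ⁅ y ⁆ B t∈U)
    B⊆U : B ⊆ U
    B⊆U t∈B = x∈p∪q⁺ {p = ⁅ y ⁆} (inj₂ t∈B)
    y∈U : y ∈ U
    y∈U = x∈p∪q⁺ (inj₁ (x∈⁅x⁆ y))
    U⊆A : U ⊆ A
    U⊆A t∈U with ∈U⁻ t∈U
    ... | inj₁ refl = y∈A
    ... | inj₂ (inj₁ refl) = x∈A
    ... | inj₂ (inj₂ refl) = z∈A
    edges : ∀ a b → (a , b) ∈ₗ F → Adj H a b × a ∈ U × b ∈ U
    edges _ _ (here refl) = x~y , B⊆U (x∈⁅x⁆∪⁅y⁆ x z) , y∈U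
    edges _ _ (there (here refl)) = y~z , y∈U , B⊆U (y∈⁅x⁆∪⁅y⁆ x z)
    to-y : ∀ {t} → t ∈ U → ∃ (Walk (EdgeRel F) t y)
    to-y t∈U with ∈U⁻ t∈U
    ... | inj₁ refl = _ , stop y
    ... | inj₂ (inj₁ refl) = _ , step (inj₁ (here refl)) (stop y)
    ... | inj₂ (inj₂ refl) = _ , step (inj₂ (there (here refl))) (stop y)
    from-y : ∀ {t} → t ∈ U → ∃ (Walk (EdgeRel F) y t)
    from-y t∈U with ∈U⁻ t∈U
    ... | inj₁ refl = _ , stop y
    ... | inj₂ (inj₁ refl) = _ , step (inj₂ (here refl)) (stop x)
    ... | inj₂ (inj₂ refl) = _ , step (inj₁ (there (here refl))) (stop z)

  sjc⇒P3-free : ∀ {A} → Is2SJC H A → ¬ InducedP3 H A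
  sjc⇒P3-free (_ , no-distance-two) (inducedP3 {x} {y} {z} x∈A y∈A z∈A x≢z x~y y~z x≁z) =
    no-distance-two (⁅ x ⁆ ∪ ⁅ z ⁆) (proj₁ path ∘ proj₁ (proj₂ path)) (∣⁅x⁆∪⁅y⁆∣≡2 x≢z)
      ((_ , _ , path , refl) , λ { _ (_ , _ , connector , refl) →
        connector-has-two-edges connector (x∈⁅x⁆∪⁅y⁆ x z) (y∈⁅x⁆∪⁅y⁆ x z) x≢z x≁z })
    where path = path-connector x∈A y∈A z∈A x~y y~z

  distance-two⇒P3 : ∀ {A B} → B ⊆ A → ∣ B ∣ ≡ 2 → SteinerDistInduced H A B 2 → InducedP3 H A
  distance-two⇒P3 {A} {B} B⊆A ∣B∣≡2 ((U , F , connector , ∣F∣≡2) , minimal) with ∣p∣≡2⇒pair B ∣B∣≡2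
  ... | x , z , x≢z , x∈B , z∈B , pair =
    common-neighbour (walk-in-≤2-edges (≤-reflexive ∣F∣≡2) (proj₂ (connector-walk connector x∈B z∈B)))
    where
    single-edge : Adj H x z → IsConnSubgraphContaining H A B B ((x , z) ∷ [])
    single-edge x~z = B⊆A , (λ t∈B → t∈B) , (λ { _ _ (here refl) → x~z , x∈B , z∈B }) , walk
      where
      walk : ∀ a b → a ∈ B → b ∈ B → ∃ (Walk (EdgeRel ((x , z) ∷ [])) a b)
      walk a b a∈B b∈B with pair a a∈B | pair b b∈B
      ... | inj₁ refl | inj₁ refl = _ , stop x
      ... | inj₁ refl | inj₂ refl = _ , step (inj₁ (here refl)) (stop z)
      ... | inj₂ refl | inj₁ refl = _ , step (inj₂ (here refl)) (stop x)
      ... | inj₂ refl | inj₂ refl = _ , stop z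
    x≁z : ¬ Adj H x z
    x≁z x~z with minimal 1 (B , _ , single-edge x~z , refl)
    ... | s≤s ()
    common-neighbour : x ≡ z ⊎ EdgeRel F x z ⊎ ∃ (λ c → EdgeRel F x c × EdgeRel F c z) → InducedP3 H A
    common-neighbour (inj₁ x≡z) = ⊥-elim (x≢z x≡z)
    common-neighbour (inj₂ (inj₁ x~z)) = ⊥-elim (x≁z (connector-adj connector x~z))
    common-neighbour (inj₂ (inj₂ (c , x~c , c~z))) =
      inducedP3 (B⊆A x∈B) (proj₁ connector (connector-endpoint connector x~c)) (B⊆A z∈B) x≢z
        (connector-adj connector x~c) (connector-adj connector c~z) x≁z

  P3-free⇒sjc : ∀ {A} → 2 ≤ ∣ A ∣ → ¬ InducedP3 H A → Is2SJC H A
  P3-free⇒sjc ∣A∣≥2 P3-free = ∣A∣≥2 , λ B B⊆A ∣B∣≡2 → P3-free ∘ distance-two⇒P3 B⊆A ∣B∣≡2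

anyFin-intro : ∀ {m} (f : Fin m → Bool) i → T (f i) → T (anyFin f)
anyFin-intro f Fin.zero t = Equivalence.from (T-∨ {f Fin.zero}) (inj₁ t)
anyFin-intro f (Fin.suc i) t = Equivalence.from (T-∨ {f Fin.zero}) (inj₂ (anyFin-intro (f ∘ Fin.suc) i t))

anyFin-elim : ∀ {m} (f : Fin m → Bool) → T (anyFin f) → ∃ λ i → T (f i)
anyFin-elim {zero} f ()
anyFin-elim {suc m} f t with Equivalence.to (T-∨ {f Fin.zero}) t
... | inj₁ t₀ = Fin.zero , t₀
... | inj₂ t₁ = Data.Product.map Fin.suc (λ t → t) (anyFin-elim (f ∘ Fin.suc) t₁)

∈─⇒∉ : ∀ {m} (p q : Subset m) {x} → x ∈ p ─ q → x ∉ q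
∈─⇒∉ (inside ∷ p) (outside ∷ q) here ()
∈─⇒∉ (_ ∷ p) (_ ∷ q) (there x∈p─q) (there x∈q) = ∈─⇒∉ p q x∈p─q x∈q

data Status (G : Graph) (S : Subset (n G)) (g : Fin (n G)) : Set where
  absent : g ∉ S → g ∉ Isol G S → g ∉ NonIsol G S → Status G S g
  isolated : g ∈ S → g ∈ Isol G S → g ∉ NonIsol G S → (∀ {g′} → g′ ∈ S → ¬ Adj G g g′) → Status G S g
  nonIsolated : g ∈ S → g ∉ Isol G S → g ∈ NonIsol G S → (∃ λ g′ → g′ ∈ S × Adj G g g′) → Status G S g

status : (G : Graph) (S : Subset (n G)) (g : Fin (n G)) → Status G S g
status G S g with g ∈ₛ? S | anyFin (λ y → lookup S y ∧ E G g y) in has-neighbour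
... | no g∉S | _ = absent g∉S (g∉S ∘ Isol⊆S) (g∉S ∘ p─q⊆p S (Isol G S))
  where
  Isol⊆S : ∀ {x} → x ∈ Isol G S → x ∈ S
  Isol⊆S x∈I = T-lookup⇒∈ (proj₁ (Equivalence.to T-∧ (∈-tabulate⁻ x∈I)))
... | yes g∈S | true = nonIsolated g∈S g∉I (x∈p∧x∉q⇒x∈p─q g∈S g∉I) neighbour
  where
  g∉I : g ∉ Isol G S
  g∉I g∈I = subst (T ∘ not) has-neighbour (proj₂ (Equivalence.to (T-∧ {lookup S g}) (∈-tabulate⁻ g∈I)))
  neighbour : ∃ λ g′ → g′ ∈ S × Adj G g g′
  neighbour with anyFin-elim _ (subst T (sym has-neighbour) tt)
  ... | g′ , t = g′ , T-lookup⇒∈ (proj₁ (Equivalence.to T-∧ t)) ,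
                 proj₂ (Equivalence.to (T-∧ {lookup S g′}) t)
... | yes g∈S | false = isolated g∈S g∈I (λ g∈J → ∈─⇒∉ S (Isol G S) g∈J g∈I) no-neighbour
  where
  g∈I : g ∈ Isol G S
  g∈I = ∈-tabulate⁺ (Equivalence.from T-∧ (∈⇒T-lookup g∈S , subst (T ∘ not) (sym has-neighbour) tt))
  no-neighbour : ∀ {g′} → g′ ∈ S → ¬ Adj G g g′
  no-neighbour {g′} g′∈S g~g′ =
    subst T has-neighbour (anyFin-intro _ g′ (Equivalence.from T-∧ (∈⇒T-lookup g′∈S , g~g′)))

bounded-max : {P : ℕ → Set} → (∀ k → Dec (P k)) → ∀ B → (∀ k → P k → k ≤ B) → ∀ {a} → P a → ∃ (IsMax P)
bounded-max {P} P? B bounded {a} Pa = search B bounded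
  where
  search : ∀ c → (∀ k → P k → k ≤ c) → ∃ (IsMax P)
  search c below with P? c
  ... | yes Pc = c , Pc , below
  search zero below | no ¬P0 with below a Pa
  ... | z≤n = ⊥-elim (¬P0 Pa)
  search (suc c) below | no ¬Pc = search c λ k Pk → ≤-pred (≤∧≢⇒< (below k Pk) λ { refl → ¬Pc Pk })

module Formula (G H : Graph) (simpleG : IsSimple G) (simpleH : IsSimple H) (s w : ℕ) where

  open Lexicographic G H simpleG simpleH
  open JoinCritical simpleH

  private
    N = n G
    M = n H
    module SG = SimpleGraph simpleG
    module SH = SimpleGraph simpleH

  formula : Subset N → ℕ
  formula S = ∣ Isol G S ∣ * s + ∣ NonIsol G S ∣ * w

  weight : Subset N → Fin N → ℕ
  weight S g = indicator (Isol G S) g * s + indicator (NonIsol G S) g * w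

  formula≡∑weight : ∀ S → formula S ≡ sum (weight S)
  formula≡∑weight S = begin
    ∣ Isol G S ∣ * s + ∣ NonIsol G S ∣ * w
      ≡⟨ cong₂ _+_ (∣p∣*c≡∑ (Isol G S) s) (∣p∣*c≡∑ (NonIsol G S) w) ⟩
    sum (λ g → indicator (Isol G S) g * s) + sum (λ g → indicator (NonIsol G S) g * w)
      ≡⟨ sym (∑-distrib-+ (λ g → indicator (Isol G S) g * s) (λ g → indicator (NonIsol G S) g * w)) ⟩
    sum (weight S) ∎
    where open ≡-Reasoning

  weight-absent : ∀ {S g} → g ∉ Isol G S → g ∉ NonIsol G S → weight S g ≡ 0
  weight-absent g∉I g∉J rewrite indicator-∉ g∉I | indicator-∉ g∉J = refl

  weight-isolated : ∀ {S g} → g ∈ Isol G S → g ∉ NonIsol G S → weight S g ≡ s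
  weight-isolated g∈I g∉J rewrite indicator-∈ g∈I | indicator-∉ g∉J = trans (+-identityʳ _) (+-identityʳ s)

  weight-nonIsolated : ∀ {S g} → g ∉ Isol G S → g ∈ NonIsol G S → weight S g ≡ w
  weight-nonIsolated g∉I g∈J rewrite indicator-∉ g∉I | indicator-∈ g∈J = +-identityʳ w

  module UpperBound (X : Subset (N * M)) (gpX : IsGPSet LG X) where

    base : Subset N
    base = tabulate λ g → ⌊ nonempty? (fibre X g) ⌋

    representative : ∀ {g} → g ∈ base → ∃ λ h → ⟨ g , h ⟩ ∈ X
    representative g∈base = Data.Product.map₂ ∈-fibre⁻ (toWitness (∈-tabulate⁻ g∈base))

    fibre-outside-base : ∀ {g} → g ∉ base → ∣ fibre X g ∣ ≡ 0
    fibre-outside-base {g} g∉base =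
      trans (cong ∣_∣ (Empty-unique λ nonempty → g∉base (∈-tabulate⁺ (fromWitness nonempty)))) (∣⊥∣≡0 M)

    base-gp : IsGPSet G base
    base-gp x y z x∈ y∈ z∈ x≢y y≢z x≢z (u , v , k , walk , shortest , x∈w , y∈w , z∈w) =
      gpX ⟨ x , f x ⟩ ⟨ y , f y ⟩ ⟨ z , f z ⟩ (at x∈ f-x) (at y∈ f-y) (at z∈ f-z)
        (⟨⟩-≢-base x≢y) (⟨⟩-≢-base y≢z) (⟨⟩-≢-base x≢z)
        (_ , _ , k , liftWalk f walk , liftWalk-shortest f walk shortest ,
         ∈-liftWalk f walk x∈w , ∈-liftWalk f walk y∈w , ∈-liftWalk f walk z∈w)
      where
      hx = proj₁ (representative x∈)
      hy = proj₁ (representative y∈)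
      hz = proj₁ (representative z∈)
      f : Fin N → Fin M
      f = updateAt (updateAt (λ _ → hz) y (λ _ → hy)) x (λ _ → hx)
      f-x : f x ≡ hx
      f-x = updateAt-updates x _
      f-y : f y ≡ hy
      f-y = trans (updateAt-minimal y x _ (x≢y ∘ sym)) (updateAt-updates y _)
      f-z : f z ≡ hz
      f-z = trans (updateAt-minimal z x _ (x≢z ∘ sym)) (updateAt-minimal z y _ (y≢z ∘ sym))
      at : ∀ {g} (g∈ : g ∈ base) {h} → h ≡ proj₁ (representative g∈) → ⟨ g , h ⟩ ∈ X
      at g∈ refl = proj₂ (representative g∈)

    fibre-P3-free : ∀ g → ¬ InducedP3 H (fibre X g)
    fibre-P3-free g (inducedP3 x∈ y∈ z∈ x≢z x~y y~z x≁z) =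
      gpX _ _ _ (∈-fibre⁻ x∈) (∈-fibre⁻ y∈) (∈-fibre⁻ z∈)
        (⟨⟩-≢-fibre (SH.adj⇒≢ x~y)) (⟨⟩-≢-fibre (SH.adj⇒≢ y~z)) (⟨⟩-≢-fibre x≢z)
        (adjacent-path-is-geodesic LG (⟨⟩-≢-fibre x≢z) (⟨⟩-nonadj-fibre x≁z) (⟨⟩-adj-fibre x~y) (⟨⟩-adj-fibre y~z))

    fibre-clique : ∀ {g g′} → g′ ∈ base → Adj G g g′ → IsClique H (fibre X g)
    fibre-clique {g} {g′} g′∈ g~g′ h h′ h∈ h′∈ h≢h′ with T? (E H h h′)
    ... | yes h~h′ = h~h′
    ... | no h≁h′ = ⊥-elim (gpX _ _ _ (∈-fibre⁻ h∈) (proj₂ (representative g′∈)) (∈-fibre⁻ h′∈)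
          (⟨⟩-≢-base (SG.adj⇒≢ g~g′)) (⟨⟩-≢-base (SG.adj⇒≢ g~g′ ∘ sym)) (⟨⟩-≢-fibre h≢h′)
          (adjacent-path-is-geodesic LG (⟨⟩-≢-fibre h≢h′) (⟨⟩-nonadj-fibre h≁h′)
            (⟨⟩-adj-base g~g′) (⟨⟩-adj-base (SG.sym-adj g~g′))))

    module _ (sjc : IsSjc2 H s) (ω : IsCliqueNumber H w) where

      fibre≤s : ∀ g → ∣ fibre X g ∣ ≤ s
      fibre≤s g with 2 ≤? ∣ fibre X g ∣
      ... | yes ≥2 = proj₂ sjc _ (fibre X g , P3-free⇒sjc ≥2 (fibre-P3-free g) , refl)
      ... | no ≱2 = ≤-trans (≤-pred (≰⇒> ≱2)) (≤-trans (s≤s z≤n) s≥2)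
        where
        s≥2 : 2 ≤ s
        s≥2 = subst (2 ≤_) (proj₂ (proj₂ (proj₁ sjc))) (proj₁ (proj₁ (proj₂ (proj₁ sjc))))

      fibre≤weight : ∀ g → ∣ fibre X g ∣ ≤ weight base g
      fibre≤weight g with status G base g
      ... | absent g∉ g∉I g∉J = ≤-reflexive (trans (fibre-outside-base g∉) (sym (weight-absent g∉I g∉J)))
      ... | isolated _ g∈I g∉J _ = ≤-trans (fibre≤s g) (≤-reflexive (sym (weight-isolated g∈I g∉J)))
      ... | nonIsolated _ g∉I g∈J (g′ , g′∈ , g~g′) =
            ≤-trans (proj₂ ω _ (fibre X g , fibre-clique g′∈ g~g′ , refl))
                    (≤-reflexive (sym (weight-nonIsolated g∉I g∈J)))

      ∣X∣≤formula : ∣ X ∣ ≤ formula base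
      ∣X∣≤formula = begin
        ∣ X ∣                     ≡⟨ ∣X∣≡∑∣fibre∣ X ⟩
        sum (λ g → ∣ fibre X g ∣) ≤⟨ sum-mono-≤ fibre≤weight ⟩
        sum (weight base)         ≡⟨ formula≡∑weight base ⟨
        formula base              ∎
        where open Data.Nat.Properties.≤-Reasoning

  module LowerBound (neighbour : ∀ g → ∃ (Adj G g))
    {A C : Subset M} (sjcA : Is2SJC H A) (∣A∣≡s : ∣ A ∣ ≡ s) (cliqueC : IsClique H C) (∣C∣≡w : ∣ C ∣ ≡ w)
    (S : Subset N) (gpS : IsGPSet G S) where

    fibreChoice : ∀ {g} → Status G S g → Subset M
    fibreChoice (absent _ _ _) = ⊥ₛ
    fibreChoice (isolated _ _ _ _) = A
    fibreChoice (nonIsolated _ _ _ _) = C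

    chosenFibre : Fin N → Subset M
    chosenFibre g = fibreChoice (status G S g)

    X : Subset (N * M)
    X = fromFibres chosenFibre

    ∣fibreChoice∣≡weight : ∀ {g} (st : Status G S g) → ∣ fibreChoice st ∣ ≡ weight S g
    ∣fibreChoice∣≡weight (absent _ g∉I g∉J) = trans (∣⊥∣≡0 M) (sym (weight-absent g∉I g∉J))
    ∣fibreChoice∣≡weight (isolated _ g∈I g∉J _) = trans ∣A∣≡s (sym (weight-isolated g∈I g∉J))
    ∣fibreChoice∣≡weight (nonIsolated _ g∉I g∈J _) = trans ∣C∣≡w (sym (weight-nonIsolated g∉I g∈J))

    ∣X∣≡formula : ∣ X ∣ ≡ formula S
    ∣X∣≡formula = begin
      ∣ X ∣                                       ≡⟨ ∣X∣≡∑∣fibre∣ X ⟩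
      sum (λ g → ∣ fibre X g ∣)                   ≡⟨ sum-cong-≗ (λ g → cong ∣_∣ (fibre-fromFibres chosenFibre g)) ⟩
      sum (λ g → ∣ fibreChoice (status G S g) ∣)  ≡⟨ sum-cong-≗ (λ g → ∣fibreChoice∣≡weight (status G S g)) ⟩
      sum (weight S)                              ≡⟨ formula≡∑weight S ⟨
      formula S                                   ∎
      where open ≡-Reasoning

    fibre-at : ∀ {x g} → x ∈ X → π₁ x ≡ g → π₂ x ∈ fibreChoice (status G S g)
    fibre-at x∈X refl = ∈-fromFibres⁻ {Φ = chosenFibre} x∈X

    base∈S : ∀ {x} → x ∈ X → π₁ x ∈ S
    base∈S {x} x∈X = chosen⇒∈S (status G S (π₁ x)) (fibre-at x∈X refl)
      where
      chosen⇒∈S : ∀ {g h} (st : Status G S g) → h ∈ fibreChoice st → g ∈ S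
      chosen⇒∈S (absent _ _ _) h∈⊥ = ⊥-elim (∉⊥ h∈⊥)
      chosen⇒∈S (isolated g∈S _ _ _) _ = g∈S
      chosen⇒∈S (nonIsolated g∈S _ _ _) _ = g∈S

    same-base-path-impossible : ∀ {g} (st : Status G S g) →
      (∀ {y} → y ∈ X → π₁ y ≡ g → π₂ y ∈ fibreChoice st) →
      ∀ {a b c} → a ∈ X → b ∈ X → c ∈ X → π₁ a ≡ g → π₁ c ≡ g → a ≢ c →
      ¬ Adj LG a c → Adj LG a b → Adj LG b c → ⊥
    same-base-path-impossible (absent _ _ _) chosen a∈ _ _ a-g _ _ _ _ _ = ∉⊥ (chosen a∈ a-g)
    same-base-path-impossible (nonIsolated _ _ _ _) chosen a∈ _ c∈ a-g c-g a≢c a≁c _ _ =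
      a≁c (adj-lex-fibre same (cliqueC _ _ (chosen a∈ a-g) (chosen c∈ c-g) (a≢c ∘ π-injective same)))
      where same = trans a-g (sym c-g)
    same-base-path-impossible (isolated _ _ _ lonely) chosen {b = b} a∈ b∈ c∈ a-g c-g a≢c a≁c a~b b~c
      with adj-lex⁻ a~b | adj-lex⁻ b~c
    ... | inj₁ ab | _ = lonely (base∈S b∈) (subst (λ t → Adj G t (π₁ b)) a-g ab)
    ... | inj₂ _ | inj₁ bc = lonely (base∈S b∈) (SG.sym-adj (subst (Adj G (π₁ b)) c-g bc))
    ... | inj₂ (ab-same , ab) | inj₂ (_ , bc) =
      sjc⇒P3-free sjcA (inducedP3 (chosen a∈ a-g) (chosen b∈ (trans (sym ab-same) a-g)) (chosen c∈ c-g)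
        (a≢c ∘ π-injective same) ab bc (a≁c ∘ adj-lex-fibre same))
      where same = trans a-g (sym c-g)

    no-between : ∀ {a b c} → a ∈ X → b ∈ X → c ∈ X → a ≢ b → b ≢ c → a ≢ c → ¬ BetweenLG a b c
    no-between {a} {c = c} a∈ b∈ c∈ a≢b b≢c a≢c betw with π₁ a ≟ π₁ c
    ... | yes same with between-same-base neighbour betw same a≢b b≢c
    ...   | a≁c , a~b , b~c =
            same-base-path-impossible (status G S (π₁ a)) fibre-at a∈ b∈ c∈ refl (sym same) a≢c a≁c a~b b~c
    no-between a∈ b∈ c∈ a≢b b≢c a≢c betw | no bases-differ =
      gpS _ _ _ (base∈S a∈) (base∈S b∈) (base∈S c∈)
        (≢-sym (middle-base≢start-base betw bases-differ a≢b))
        (middle-base≢end-base betw bases-differ b≢c) bases-differ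
        (between-projects-to-geodesic betw bases-differ)

    X-gp : IsGPSet LG X
    X-gp x y z x∈ y∈ z∈ x≢y y≢z x≢z (_ , _ , _ , walk , shortest , x∈w , y∈w , z∈w)
      with between-on-shortest walk shortest x∈w y∈w z∈w
    ... | inj₁ yxz = no-between y∈ x∈ z∈ (≢-sym x≢y) x≢z y≢z yxz
    ... | inj₂ (inj₁ zxy) = no-between z∈ x∈ y∈ (≢-sym x≢z) x≢y (≢-sym y≢z) zxy
    ... | inj₂ (inj₂ (inj₁ xyz)) = no-between x∈ y∈ z∈ x≢y y≢z x≢z xyz
    ... | inj₂ (inj₂ (inj₂ (inj₁ xzy))) = no-between x∈ z∈ y∈ x≢z (≢-sym y≢z) x≢y xzy
    ... | inj₂ (inj₂ (inj₂ (inj₂ (inj₁ yzx)))) = no-between y∈ z∈ x∈ y≢z (≢-sym x≢z) (≢-sym x≢y) yzx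
    ... | inj₂ (inj₂ (inj₂ (inj₂ (inj₂ zyx)))) = no-between z∈ y∈ x∈ (≢-sym y≢z) (≢-sym x≢y) (≢-sym x≢z) zyx

  Realisable : ℕ → Set
  Realisable k = Σ (Subset N) λ S → IsGPSet G S × k ≡ formula S

  empty-realisable : Realisable (formula ⊥ₛ)
  empty-realisable = ⊥ₛ , (λ _ _ _ x∈⊥ → ⊥-elim (∉⊥ x∈⊥)) , refl

  module Maximum (neighbour : ∀ g → ∃ (Adj G g)) (connected : Connected G)
    (sjc : IsSjc2 H s) (ω : IsCliqueNumber H w) where

    private
      module Lower = LowerBound neighbour (proj₁ (proj₂ (proj₁ sjc))) (proj₂ (proj₂ (proj₁ sjc)))
                                          (proj₁ (proj₂ (proj₁ ω))) (proj₂ (proj₂ (proj₁ ω)))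

    realisable? : ∀ k → Dec (Realisable k)
    realisable? k = anySubset? λ S → ConnectedGraph.isGPSet? G connected S ×-dec (k ≟ℕ formula S)

    realisable≤ : ∀ k → Realisable k → k ≤ N * M
    realisable≤ _ (S , gpS , refl) = subst (_≤ N * M) (Lower.∣X∣≡formula S gpS) (∣p∣≤n (Lower.X S gpS))

    max-realisable-is-gp : ∀ {k} → IsMax Realisable k → IsGP LG k
    max-realisable-is-gp ((S , gpS , refl) , maximal) =
      (Lower.X S gpS , Lower.X-gp S gpS , Lower.∣X∣≡formula S gpS) ,
      λ { _ (Y , gpY , refl) → ≤-trans (UpperBound.∣X∣≤formula Y gpY sjc ω)
                                        (maximal _ (UpperBound.base Y gpY , UpperBound.base-gp Y gpY , refl)) }

theorem5p3 : (G H : Graph) → IsSimple G → IsSimple H → Nontrivial G → Nontrivial H →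
    Connected G → (s w : ℕ) → IsSjc2 H s → IsCliqueNumber H w →
    ∃ λ k → IsGP (lex G H) k ×
      IsMax (λ m → Σ (Subset (n G)) λ S → IsGPSet G S ×
        m ≡ ∣ Isol G S ∣ * s + ∣ NonIsol G S ∣ * w) k
theorem5p3 G H simpleG simpleH nontrivialG _ connectedG s w sjc ω =
  let k , maximum = bounded-max realisable? (n G * n H) realisable≤ empty-realisable
  in k , max-realisable-is-gp maximum , maximum
  where
  open Formula G H simpleG simpleH s w
  open Maximum (has-neighbour G nontrivialG connectedG) connectedG sjc ω
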